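{- In the semigroup $({\mathcal P}_f(\mathbb N),\cup)$, let ${\mathcal A}=\{X\in{\mathcal P}_f(\mathbb N):1\notin X\}$. Then $d({\mathcal A})=0$, but there is a F\o lner sequence $\langle{\mathcal F}_n\rangle_{n\in\mathbb N}$ in ${\mathcal P}_f({\mathcal P}_f(\mathbb N))$ such that $$\lim_{n\to\infty}\max_{T\in{\mathcal P}_f(\mathbb N)}\frac{|{\mathcal A}\cap\{Z\cup T:Z\in{\mathcal F}_n\}|}{|\{Z\cup T:Z\in{\mathcal F}_n\}|}=\frac12.$$
   Context: ${\mathcal P}_f(X)$ is the set of finite nonempty subsets of $X$; $\mathbb N=\{1,2,\dots\}$. $({\mathcal P}_f(\mathbb N),\cup)$ is commutative and satisfies the Strong F\o lner Condition. For a semigroup $S$, a F\o lner sequence is a sequence $\langle F_n\rangle$ in ${\mathcal P}_f(S)$ with $\lim_n|F_n\setminus sF_n|/|F_n|=0$ for all $s\in S$. $d(A)$ is the supremum of $\alpha\in[0,1]$ such that for every $H\in{\mathcal P}_f(S)$ and $\epsilon>0$ there is $K\in{\mathcal P}_f(S)$ with $|K\setminus sK|<\epsilon|K|$ for all $s\in H$ and $|A\cap K|\ge\alpha|K|$. -}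

module Defs where

open import Data.Nat as ℕ using (ℕ; zero; suc; _<_; _≤_)
open import Data.Nat.Properties using (<-cmp; _≟_)
open import Data.Integer using (+_)
open import Data.Rational as ℚ using (ℚ; 0ℚ; _/_; ∣_∣; _-_; _*_)
open import Data.List using (List; []; _∷_; length; foldr; map; filter; deduplicate)
open import Data.List.Properties using (≡-dec)
open import Data.List.Relation.Unary.All using (All)
open import Data.List.Relation.Unary.Linked using (Linked)
open import Data.List.Relation.Unary.Unique.Propositional using (Unique)
import Data.List.Membership.DecPropositional as DecMem
open import Data.List.Membership.Propositional using (_∈_)
open import Data.Product using (_×_; ∃)
open import Relation.Binary using (tri<; tri≈; tri>)
open import Relation.Binary.PropositionalEquality using (_≡_; _≢_)
open import Relation.Nullary using (¬_; ¬?)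
open import Relation.Unary using (Pred; Decidable)
open import Level using (0ℓ)

-- An element of P_f(ℕ) is represented canonically by the strictly
-- increasing nonempty list of its elements (all ≥ 1), so that equality of
-- sets is propositional equality of lists.

IsPf : List ℕ → Set
IsPf xs = (xs ≢ []) × Linked _<_ xs × All (λ x → 1 ≤ x) xs

insert : ℕ → List ℕ → List ℕ
insert x [] = x ∷ []
insert x (y ∷ ys) with <-cmp x y
... | tri< _ _ _ = x ∷ y ∷ ys
... | tri≈ _ _ _ = y ∷ ys
... | tri> _ _ _ = y ∷ insert x ys

_∪_ : List ℕ → List ℕ → List ℕ
xs ∪ ys = foldr insert ys xs

open DecMem _≟_ using () renaming (_∈?_ to _∈ℕ?_)
open DecMem (≡-dec _≟_) using () renaming (_∈?_ to _∈S?_)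

-- Finite nonempty subsets of S, i.e. elements of P_f(P_f(ℕ)): duplicate-free
-- nonempty lists of elements of S; the cardinality is the length.

IsPfS : List (List ℕ) → Set
IsPfS K = (K ≢ []) × All IsPf K × Unique K

image : (List ℕ → List ℕ) → List (List ℕ) → List (List ℕ)
image f K = deduplicate (≡-dec _≟_) (map f K)

_·_ : List ℕ → List (List ℕ) → List (List ℕ)
s · K = image (λ Z → s ∪ Z) K

_∖_ : List (List ℕ) → List (List ℕ) → List (List ℕ)
K ∖ L = filter (λ Z → ¬? (Z ∈S? L)) K

_∩_ : {A : Pred (List ℕ) 0ℓ} → Decidable A → List (List ℕ) → List (List ℕ)
A? ∩ K = filter A? K

𝒜 : Pred (List ℕ) 0ℓ
𝒜 X = ¬ (1 ∈ X)

𝒜? : Decidable 𝒜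
𝒜? X = ¬? (1 ∈ℕ? X)

toℚ : ℕ → ℚ
toℚ n = + n / 1

-- a / b as a rational number (only used with b ≠ 0; set to 0 when b = 0)
ratio : ℕ → ℕ → ℚ
ratio a zero = 0ℚ
ratio a (suc b) = + a / suc b

Tendsto : (ℕ → ℚ) → ℚ → Set
Tendsto r L = ∀ ε → 0ℚ ℚ.< ε → ∃ λ N → ∀ n → N ≤ n → ∣ r n - L ∣ ℚ.< ε

IsFolner : (ℕ → List (List ℕ)) → Set
IsFolner F =
  (∀ n → IsPfS (F n)) ×
  (∀ s → IsPf s → Tendsto (λ n → ratio (length (F n ∖ (s · F n))) (length (F n))) 0ℚ)

-- DensityAtLeast A? α says that α belongs to the set whose
-- supremum is d(A): for every H ∈ P_f(S) and ε > 0 there is K ∈ P_f(S)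
-- with |K \ sK| < ε|K| for all s ∈ H and |A ∩ K| ≥ α|K|.

DensityAtLeast : {A : Pred (List ℕ) 0ℓ} → Decidable A → ℚ → Set
DensityAtLeast A? α =
  ∀ H → H ≢ [] → All IsPf H →
  ∀ ε → 0ℚ ℚ.< ε →
  ∃ λ K → IsPfS K ×
    All (λ s → toℚ (length (K ∖ (s · K))) ℚ.< ε * toℚ (length K)) H ×
    α * toℚ (length K) ℚ.≤ toℚ (length (A? ∩ K))

-- d(A) = 0: 0 is in the set (α ∈ [0,1]) and no α > 0 is, i.e. its
-- supremum is 0 (rational α suffice, as the set is downward closed and
-- the rationals are dense in the reals).
DensityZero : {A : Pred (List ℕ) 0ℓ} → Decidable A → Set
DensityZero A? = DensityAtLeast A? 0ℚ × (∀ α → 0ℚ ℚ.< α → ¬ DensityAtLeast A? α)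

-- The Følner sets 𝓕 n consist of {2,…,n+2} together with the n+1 initial
-- segments {1,…,n+k+2}, k ≤ n.  Once n bounds max s, every segment absorbs s,
-- so s 𝓕 n can miss at most one of the n+2 sets: 𝓕 is Følner.  After a union
-- with any T, all segments land in sets containing 1, so at most one element of
-- {Z ∪ T : Z ∈ 𝓕 n} avoids 1 and the proportion is at most ½; for
-- T = {2,…,2n+2} the translates are exactly T and {1} ∪ T, giving ½.
-- Meanwhile every element of {1} K contains 1, so 𝒜 ∩ K ⊆ K ∖ {1} K, and
-- approximate invariance under {1} forces |𝒜 ∩ K| to be small: d(𝒜) = 0.
-- (That 0 is attained is witnessed by {{1,…,M}}, fixed by every s ∈ H once
-- M bounds ⋃ H.)
module Submission where

open import Defs
open import Data.Empty using (⊥-elim)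
open import Data.Integer as ℤ using (+_; +≤+; +<+)
import Data.Integer.Properties as ℤP
open import Data.List using (List; []; _∷_; length; map; filter; deduplicate; applyUpTo; concat)
open import Data.List.Extrema.Nat using (max; xs≤max)
open import Data.List.Membership.Propositional using (_∈_)
open import Data.List.Membership.Propositional.Properties
  using (∈-filter⁻; ∈-deduplicate⁺; ∈-deduplicate⁻; ∈-map⁺; ∈-map⁻; ∈-applyUpTo⁻)
open import Data.List.Properties using (≡-dec; filter-none; filter-accept; filter-reject; length-applyUpTo)
open import Data.List.Relation.Binary.Sublist.Propositional using (_⊆_; []; _∷_; ⊆-refl; ⊆-trans)
open import Data.List.Relation.Binary.Sublist.Propositional.Properties
  using (filter-⊆; filter⁺; length-mono-≤; All-resp-⊆)
open import Data.List.Relation.Unary.All as All using (All; []; _∷_)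
import Data.List.Relation.Unary.All.Properties as AllP
open import Data.List.Relation.Unary.Any using (here; there)
open import Data.List.Relation.Unary.AllPairs using ([]; _∷_)
open import Data.List.Relation.Unary.Linked as Linked using (Linked; []; [-]; _∷_)
open import Data.List.Relation.Unary.Linked.Properties using (Linked⇒AllPairs)
open import Data.List.Relation.Unary.Unique.Propositional.Properties using (applyUpTo⁺₁)
open import Data.Nat using (ℕ; zero; suc; _+_; _*_; _⊔_; _≤_; _<_; z≤n; s≤s)
open import Data.Nat.Properties as ℕP using (<-cmp; _≟_; ≤-refl; ≤-trans; module ≤-Reasoning)
open import Data.Product using (_×_; _,_; ∃; proj₁)
open import Data.Sum using (inj₁; inj₂)
open import Data.Rational as ℚ using (ℚ; 0ℚ; ½; mkℚ)
import Data.Rational.Properties as ℚP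
open import Data.Rational.Unnormalised using (mkℚᵘ; *≤*; *<*)
import Data.Rational.Unnormalised.Properties as ℚᵘP
open import Function using (_∘_)
open import Relation.Binary using (tri<; tri≈; tri>)
open import Relation.Binary.Definitions using (DecidableEquality)
open import Relation.Binary.PropositionalEquality
open import Relation.Nullary using (¬_; ¬?; yes; no)
open import Relation.Unary using (Pred; Decidable)
open import Data.List.Membership.DecPropositional (≡-dec _≟_) using (_∈?_)

cross-mul-≤ : ∀ {a b c d} → a * suc d ≤ c * suc b → + a ℚ./ suc b ℚ.≤ + c ℚ./ suc d
cross-mul-≤ {a} {b} {c} {d} h =
  ℚP.toℚᵘ-cancel-≤
    (ℚᵘP.≤-respˡ-≃ (ℚᵘP.≃-sym (ℚP.toℚᵘ-fromℚᵘ (mkℚᵘ (+ a) b)))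
      (ℚᵘP.≤-respʳ-≃ (ℚᵘP.≃-sym (ℚP.toℚᵘ-fromℚᵘ (mkℚᵘ (+ c) d)))
        (*≤* (subst₂ ℤ._≤_ (ℤP.pos-* a (suc d)) (ℤP.pos-* c (suc b)) (+≤+ h)))))

cross-mul-< : ∀ {a b c d} → a * suc d < c * suc b → + a ℚ./ suc b ℚ.< + c ℚ./ suc d
cross-mul-< {a} {b} {c} {d} h =
  ℚP.toℚᵘ-cancel-<
    (ℚᵘP.<-respˡ-≃ (ℚᵘP.≃-sym (ℚP.toℚᵘ-fromℚᵘ (mkℚᵘ (+ a) b)))
      (ℚᵘP.<-respʳ-≃ (ℚᵘP.≃-sym (ℚP.toℚᵘ-fromℚᵘ (mkℚᵘ (+ c) d)))
        (*<* (subst₂ ℤ._<_ (ℤP.pos-* a (suc d)) (ℤP.pos-* c (suc b)) (+<+ h)))))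

toℚ-mono-≤ : ∀ {a c} → a ≤ c → toℚ a ℚ.≤ toℚ c
toℚ-mono-≤ {a} {c} h = cross-mul-≤ {a} {0} {c} {0} (ℕP.*-monoˡ-≤ 1 h)

positive⇒1/suc≤ : ∀ {ε} → 0ℚ ℚ.< ε → ∃ λ d → + 1 ℚ./ suc d ℚ.≤ ε
positive⇒1/suc≤ {mkℚ (+ suc a) d _} _ =
  d , subst (+ 1 ℚ./ suc d ℚ.≤_) (ℚP.fromℚᵘ-toℚᵘ _)
          (cross-mul-≤ {1} {d} {suc a} {d} (ℕP.*-monoˡ-≤ (suc d) (s≤s (z≤n {a}))))
positive⇒1/suc≤ {mkℚ (+ zero) d _} (ℚ.*<* q) = ⊥-elim (ℤP.<-irrefl refl q)
positive⇒1/suc≤ {mkℚ ℤ.-[1+ a ] d _} p = ⊥-elim (ℚP.<-asym p (ℚP.negative⁻¹ _))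

ratio-nonneg : ∀ a b → 0ℚ ℚ.≤ ratio a b
ratio-nonneg a zero = ℚP.≤-refl
ratio-nonneg a (suc b) = cross-mul-≤ {0} {0} {a} {b} z≤n

ratio≤1-< : ∀ {k b d} → k ≤ 1 → suc d < b → ratio k b ℚ.< + 1 ℚ./ suc d
ratio≤1-< {k} {suc b} {d} k≤1 d<b = cross-mul-< {k} {b} {1} {d} (begin-strict
  k * suc d  ≤⟨ ℕP.*-monoˡ-≤ (suc d) k≤1 ⟩
  1 * suc d  ≡⟨ ℕP.*-identityˡ (suc d) ⟩
  suc d      <⟨ d<b ⟩
  suc b      ≡⟨ ℕP.*-identityˡ (suc b) ⟨
  1 * suc b  ∎)
  where open ≤-Reasoning

ratio≤½ : ∀ {c b} → c ≤ 1 → (1 ≤ c → 2 ≤ b) → ratio c b ℚ.≤ ½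
ratio≤½ {zero} {zero} _ _ = cross-mul-≤ {0} {0} {1} {1} z≤n
ratio≤½ {zero} {suc b} _ _ = cross-mul-≤ {0} {b} {1} {1} z≤n
ratio≤½ {suc zero} {b} _ two with two (s≤s z≤n)
... | s≤s (s≤s {n = b′} _) = cross-mul-≤ {1} {suc b′} {1} {1} (s≤s (s≤s z≤n))
ratio≤½ {suc (suc c)} (s≤s ()) _

tendsto-0 : ∀ (c b : ℕ → ℕ) M → (∀ n → M ≤ n → c n ≤ 1) → (∀ n → n < b n) →
            Tendsto (λ n → ratio (c n) (b n)) 0ℚ
tendsto-0 c b M c≤1 n<b ε ε>0 with d , 1/d≤ε ← positive⇒1/suc≤ ε>0 =
  M ⊔ suc d , λ n N≤n →
    subst (ℚ._< ε) (sym (∣p-0∣≡p (ratio-nonneg (c n) (b n))))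
      (ℚP.<-≤-trans (ratio≤1-< (c≤1 n (ℕP.m⊔n≤o⇒m≤o M (suc d) N≤n))
                              (ℕP.≤-<-trans (ℕP.m⊔n≤o⇒n≤o M (suc d) N≤n) (n<b n)))
                    1/d≤ε)
  where
  ∣p-0∣≡p : ∀ {p} → 0ℚ ℚ.≤ p → ℚ.∣ p ℚ.- 0ℚ ∣ ≡ p
  ∣p-0∣≡p {p} 0≤p = trans (cong ℚ.∣_∣ (ℚP.+-identityʳ p)) (ℚP.0≤p⇒∣p∣≡p 0≤p)

tendsto-const : ∀ {r : ℕ → ℚ} {q} → (∀ n → r n ≡ q) → Tendsto r q
tendsto-const {r} {q} r≡q ε ε>0 =
  0 , λ n _ → subst (λ x → ℚ.∣ x ℚ.- q ∣ ℚ.< ε) (sym (r≡q n))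
                (subst (ℚ._< ε) (sym (cong ℚ.∣_∣ (ℚP.+-inverseʳ q))) ε>0)

module _ {a} {A : Set a} where

  deduplicate-⊆ : (_≟ₐ_ : DecidableEquality A) (xs : List A) → deduplicate _≟ₐ_ xs ⊆ xs
  deduplicate-⊆ _≟ₐ_ [] = []
  deduplicate-⊆ _≟ₐ_ (x ∷ xs) = refl ∷ ⊆-trans (filter-⊆ _ _) (deduplicate-⊆ _≟ₐ_ xs)

  deduplicate-const : (_≟ₐ_ : DecidableEquality A) {x y : A} {xs : List A} →
                      All (_≡ y) (x ∷ xs) → deduplicate _≟ₐ_ (x ∷ xs) ≡ y ∷ []
  deduplicate-const _≟ₐ_ {xs = xs} (refl ∷ xs≡y) =
    cong (_ ∷_) (filter-none _ (All.map (λ z≡y y≢z → y≢z (sym z≡y))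
                                        (All-resp-⊆ (deduplicate-⊆ _≟ₐ_ xs) xs≡y)))

  two≤length : ∀ {x y : A} {xs} → x ∈ xs → y ∈ xs → x ≢ y → 2 ≤ length xs
  two≤length (here refl) (here refl) x≢y = ⊥-elim (x≢y refl)
  two≤length {xs = _ ∷ _ ∷ _} _ _ _ = s≤s (s≤s z≤n)
  two≤length {xs = _ ∷ []} (here refl) (there ()) _
  two≤length {xs = _ ∷ []} (there ()) _ _

  module _ {p} {P : Pred A p} (P? : Decidable P) where

    length-filter-deduplicate : (_≟ₐ_ : DecidableEquality A) (xs : List A) →
      length (filter P? (deduplicate _≟ₐ_ xs)) ≤ length (filter P? xs)
    length-filter-deduplicate _≟ₐ_ xs =
      length-mono-≤ (filter⁺ P? P? (λ { refl Px → Px }) (deduplicate-⊆ _≟ₐ_ xs))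

    length-filter-mono : ∀ {q} {Q : Pred A q} (Q? : Decidable Q) → (∀ {x} → P x → Q x) →
                         (xs : List A) → length (filter P? xs) ≤ length (filter Q? xs)
    length-filter-mono Q? P⇒Q xs = length-mono-≤ (filter⁺ P? Q? (λ { refl → P⇒Q }) (⊆-refl {x = xs}))

    length-filter-∷≤1 : ∀ {x xs} → All (¬_ ∘ P) xs → length (filter P? (x ∷ xs)) ≤ 1
    length-filter-∷≤1 {x} none with P? x
    ... | yes _ = ℕP.≤-reflexive (cong (suc ∘ length) (filter-none P? none))
    ... | no _ = ℕP.≤-trans (ℕP.≤-reflexive (cong length (filter-none P? none))) z≤n

    ratio-filter≤½ : ∀ {y xs} → length (filter P? xs) ≤ 1 → y ∈ xs → ¬ P y →
                     ratio (length (filter P? xs)) (length xs) ℚ.≤ ½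
    ratio-filter≤½ {y} {xs} c≤1 y∈xs ¬Py = ratio≤½ c≤1 two
      where
      two : 1 ≤ length (filter P? xs) → 2 ≤ length xs
      two 1≤c with filter P? xs in eq
      two 1≤c | x ∷ _ with x∈xs , Px ← ∈-filter⁻ P? (subst (x ∈_) (sym eq) (here refl)) =
        two≤length x∈xs y∈xs (λ { refl → ¬Py Px })

interval : ℕ → ℕ → List ℕ
interval a zero = []
interval a (suc l) = a ∷ interval (suc a) l

segment : ℕ → List ℕ
segment = interval 1

∈-interval⁺ : ∀ {a l x} → a ≤ x → x < a + l → x ∈ interval a l
∈-interval⁺ {a} {zero} {x} a≤x x<a+0 =
  ⊥-elim (ℕP.<-irrefl refl (ℕP.≤-<-trans a≤x (subst (x <_) (ℕP.+-identityʳ a) x<a+0)))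
∈-interval⁺ {a} {suc l} {x} a≤x x<a+l with ℕP.m≤n⇒m<n∨m≡n a≤x
... | inj₂ refl = here refl
... | inj₁ a<x = there (∈-interval⁺ a<x (subst (x <_) (ℕP.+-suc a l) x<a+l))

∈-interval⁻ : ∀ {a l x} → x ∈ interval a l → a ≤ x × x < a + l
∈-interval⁻ {a} {suc l} (here refl) = ≤-refl , ℕP.m<m+n a (s≤s z≤n)
∈-interval⁻ {a} {suc l} {x} (there x∈) with a<x , x<a+l ← ∈-interval⁻ x∈ =
  ℕP.<⇒≤ a<x , subst (x <_) (sym (ℕP.+-suc a l)) x<a+l

interval-linked : ∀ a l → Linked _<_ (interval a l)
interval-linked a zero = []
interval-linked a (suc zero) = [-]
interval-linked a (suc (suc l)) = ℕP.n<1+n a ∷ interval-linked (suc a) (suc l)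

interval-isPf : ∀ {a} l → 1 ≤ a → IsPf (interval a (suc l))
interval-isPf {a} l 1≤a =
  (λ ()) , interval-linked a (suc l) , All.tabulate (λ x∈ → ≤-trans 1≤a (proj₁ (∈-interval⁻ x∈)))

length-interval : ∀ a l → length (interval a l) ≡ l
length-interval a zero = refl
length-interval a (suc l) = cong suc (length-interval (suc a) l)

interval-⊆ : ∀ {a l l′} → l ≤ l′ → All (_∈ interval a l′) (interval a l)
interval-⊆ {a} l≤l′ = All.tabulate λ x∈ →
  let a≤x , x<a+l = ∈-interval⁻ x∈ in ∈-interval⁺ a≤x (ℕP.<-≤-trans x<a+l (ℕP.+-monoʳ-≤ a l≤l′))

⊆-segment : ∀ {s m} → All (1 ≤_) s → All (_≤ m) s → All (_∈ segment m) s
⊆-segment 1≤s s≤m = All.zipWith (λ (1≤x , x≤m) → ∈-interval⁺ 1≤x (s≤s x≤m)) (1≤s , s≤m)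

∈-insert : ∀ x ys → x ∈ insert x ys
∈-insert x [] = here refl
∈-insert x (y ∷ ys) with <-cmp x y
... | tri< _ _ _ = here refl
... | tri≈ _ x≡y _ = here x≡y
... | tri> _ _ _ = there (∈-insert x ys)

insert-absorbs : ∀ {x ys} → Linked _<_ ys → x ∈ ys → insert x ys ≡ ys
insert-absorbs {x} _ (here refl) with <-cmp x x
... | tri< x<x _ _ = ⊥-elim (ℕP.<-irrefl refl x<x)
... | tri≈ _ _ _ = refl
... | tri> _ _ x<x = ⊥-elim (ℕP.<-irrefl refl x<x)
insert-absorbs {x} {y ∷ ys} ys↑ (there x∈ys) with <-cmp x y | Linked⇒AllPairs ℕP.<-trans ys↑
... | tri< x<y _ _ | y<ys ∷ _ = ⊥-elim (ℕP.<-irrefl refl (ℕP.<-trans x<y (All.lookup y<ys x∈ys)))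
... | tri≈ _ _ _ | _ = refl
... | tri> _ _ _ | _ = cong (y ∷_) (insert-absorbs (Linked.tail ys↑) x∈ys)

∪-absorbs : ∀ {s X} → Linked _<_ X → All (_∈ X) s → s ∪ X ≡ X
∪-absorbs X↑ [] = refl
∪-absorbs X↑ (x∈X ∷ s⊆X) = trans (cong (insert _) (∪-absorbs X↑ s⊆X)) (insert-absorbs X↑ x∈X)

∪-absorbs-segment : ∀ {s m} → IsPf s → All (_≤ m) s → s ∪ segment m ≡ segment m
∪-absorbs-segment (_ , _ , 1≤s) s≤m = ∪-absorbs (interval-linked 1 _) (⊆-segment 1≤s s≤m)

𝓕-segment : ℕ → ℕ → List ℕ
𝓕-segment n k = segment (suc (suc (n + k)))

segments : ℕ → List (List ℕ)
segments n = applyUpTo (𝓕-segment n) (suc n)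

𝓕 : ℕ → List (List ℕ)
𝓕 n = interval 2 (suc n) ∷ segments n

∈-segments⁻ : ∀ {n Z} → Z ∈ segments n → ∃ λ k → k ≤ n × Z ≡ 𝓕-segment n k
∈-segments⁻ {n} Z∈ with k , s≤s k≤n , refl ← ∈-applyUpTo⁻ (𝓕-segment n) Z∈ = k , k≤n , refl

length-𝓕 : ∀ n → length (𝓕 n) ≡ suc (suc n)
length-𝓕 n = cong suc (length-applyUpTo (𝓕-segment n) (suc n))

𝓕-isPfS : ∀ n → IsPfS (𝓕 n)
𝓕-isPfS n =
  (λ ()) ,
  (interval-isPf n (s≤s z≤n) ∷
     AllP.applyUpTo⁺₂ (𝓕-segment n) (suc n) (λ k → interval-isPf (suc (n + k)) ≤-refl)) ,
  (All.tabulate head∉segments ∷ applyUpTo⁺₁ (𝓕-segment n) (suc n) (λ i<j _ → segments-differ i<j))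
  where
  head∉segments : ∀ {Z} → Z ∈ segments n → interval 2 (suc n) ≢ Z
  head∉segments Z∈ with _ , _ , refl ← ∈-segments⁻ Z∈ = λ ()
  segments-differ : ∀ {i j} → i < j → 𝓕-segment n i ≢ 𝓕-segment n j
  segments-differ {i} {j} i<j eq = ℕP.<⇒≢ i<j (ℕP.+-cancelˡ-≡ (suc (suc n)) i j (begin
    suc (suc n) + i           ≡⟨ length-interval 1 _ ⟨
    length (𝓕-segment n i)    ≡⟨ cong length eq ⟩
    length (𝓕-segment n j)    ≡⟨ length-interval 1 _ ⟩
    suc (suc n) + j           ∎))
    where open ≡-Reasoning

segments-absorb : ∀ {s n} → IsPf s → max 0 s ≤ n → All (λ Z → s ∪ Z ≡ Z) (segments n)
segments-absorb {s} {n} s-pf max≤n = AllP.applyUpTo⁺₂ (𝓕-segment n) (suc n) λ k →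
  ∪-absorbs-segment s-pf (All.map (λ x≤max → ≤-trans x≤max max≤segment-end) (xs≤max 0 s))
  where
  max≤segment-end : ∀ {k} → max 0 s ≤ suc (suc (n + k))
  max≤segment-end {k} = ≤-trans max≤n (ℕP.m≤n⇒m≤1+n (ℕP.m≤n⇒m≤1+n (ℕP.m≤m+n n k)))

𝓕-almost-invariant : ∀ {s n} → IsPf s → max 0 s ≤ n → length (𝓕 n ∖ (s · 𝓕 n)) ≤ 1
𝓕-almost-invariant {s} {n} s-pf max≤n =
  length-filter-∷≤1 (λ Z → ¬? (Z ∈? (s · 𝓕 n))) {interval 2 (suc n)} {segments n}
    (All.tabulate (λ Z∈ Z∉ → Z∉ (translate∈ Z∈)))
  where
  translate∈ : ∀ {Z} → Z ∈ segments n → Z ∈ s · 𝓕 n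
  translate∈ Z∈ = ∈-deduplicate⁺ (≡-dec _≟_)
    (subst (_∈ map (s ∪_) (𝓕 n)) (All.lookup (segments-absorb s-pf max≤n) Z∈) (∈-map⁺ (s ∪_) (there Z∈)))

𝓕-isFolner : IsFolner 𝓕
𝓕-isFolner = 𝓕-isPfS , λ s s-pf →
  tendsto-0 _ (length ∘ 𝓕) (max 0 s) (λ _ → 𝓕-almost-invariant s-pf)
            (λ n → subst (n <_) (sym (length-𝓕 n)) (ℕP.m<n⇒m<1+n (ℕP.n<1+n n)))

translates : List ℕ → ℕ → List (List ℕ)
translates T n = image (λ Z → Z ∪ T) (𝓕 n)

1∈segment∪ : ∀ m T → 1 ∈ segment (suc m) ∪ T
1∈segment∪ m T = ∈-insert 1 (interval 2 m ∪ T)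

translates-count≤1 : ∀ T n → length (𝒜? ∩ translates T n) ≤ 1
translates-count≤1 T n =
  ≤-trans (length-filter-deduplicate 𝒜? (≡-dec _≟_) (map (_∪ T) (𝓕 n)))
          (length-filter-∷≤1 𝒜? {interval 2 (suc n) ∪ T} {map (_∪ T) (segments n)}
            (AllP.map⁺ (AllP.applyUpTo⁺₂ (𝓕-segment n) (suc n)
                                        (λ k 1∉ → 1∉ (1∈segment∪ (suc (n + k)) T)))))

translates-ratio≤½ : ∀ T n → ratio (length (𝒜? ∩ translates T n)) (length (translates T n)) ℚ.≤ ½
translates-ratio≤½ T n =
  ratio-filter≤½ 𝒜? (translates-count≤1 T n) segment∪T∈ (λ 1∉ → 1∉ (1∈segment∪ (suc (n + 0)) T))
  where
  segment∪T∈ : 𝓕-segment n 0 ∪ T ∈ translates T n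
  segment∪T∈ = ∈-deduplicate⁺ (≡-dec _≟_) {map (_∪ T) (𝓕 n)} (there (here refl))

T⋆ : ℕ → List ℕ
T⋆ n = interval 2 (suc (n + n))

1∉T⋆ : ∀ n → ¬ 1 ∈ T⋆ n
1∉T⋆ n 1∈ with s≤s () ← proj₁ (∈-interval⁻ 1∈)

head∪T⋆ : ∀ n → interval 2 (suc n) ∪ T⋆ n ≡ T⋆ n
head∪T⋆ n = ∪-absorbs (interval-linked 2 _) (interval-⊆ (s≤s (ℕP.m≤m+n n n)))

segments∪T⋆ : ∀ n → All (λ Z → Z ∪ T⋆ n ≡ 1 ∷ T⋆ n) (segments n)
segments∪T⋆ n = AllP.applyUpTo⁺₁ (𝓕-segment n) (suc n) λ { (s≤s k≤n) →
  cong (insert 1) (∪-absorbs (interval-linked 2 _) (interval-⊆ (s≤s (ℕP.+-monoʳ-≤ n k≤n)))) }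

translates-T⋆ : ∀ n → translates (T⋆ n) n ≡ T⋆ n ∷ (1 ∷ T⋆ n) ∷ []
translates-T⋆ n = begin
  translates (T⋆ n) n
    ≡⟨ cong (λ X → X ∷ filter (¬? ∘ ≡-dec _≟_ X) translated-segments) (head∪T⋆ n) ⟩
  T⋆ n ∷ filter (¬? ∘ ≡-dec _≟_ (T⋆ n)) translated-segments
    ≡⟨ cong (λ L → T⋆ n ∷ filter (¬? ∘ ≡-dec _≟_ (T⋆ n)) L)
            (deduplicate-const (≡-dec _≟_) (AllP.map⁺ (segments∪T⋆ n))) ⟩
  T⋆ n ∷ filter (¬? ∘ ≡-dec _≟_ (T⋆ n)) ((1 ∷ T⋆ n) ∷ [])
    ≡⟨ cong (T⋆ n ∷_) (filter-accept (¬? ∘ ≡-dec _≟_ (T⋆ n)) {xs = []}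
                                     (λ eq → 1∉T⋆ n (subst (1 ∈_) (sym eq) (here refl)))) ⟩
  T⋆ n ∷ (1 ∷ T⋆ n) ∷ [] ∎
  where
  open ≡-Reasoning
  translated-segments : List (List ℕ)
  translated-segments = deduplicate (≡-dec _≟_) (map (_∪ T⋆ n) (segments n))

ratio-T⋆ : ∀ n → ratio (length (𝒜? ∩ translates (T⋆ n) n)) (length (translates (T⋆ n) n)) ≡ ½
ratio-T⋆ n = trans (cong (λ L → ratio (length (𝒜? ∩ L)) (length L)) (translates-T⋆ n))
                   (cong (λ L → ratio (length L) 2) (filter-accept 𝒜? {xs = (1 ∷ T⋆ n) ∷ []} (1∉T⋆ n)))

density-0 : DensityAtLeast 𝒜? 0ℚ
density-0 H _ H-pf ε ε>0 =
  K , K-isPfS , All.tabulate K-invariant ,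
  -- 0ℚ * toℚ 1 computes to toℚ 0
  toℚ-mono-≤ {0} {length (𝒜? ∩ K)} z≤n
  where
  M : ℕ
  M = max 0 (concat H)
  K : List (List ℕ)
  K = segment (suc M) ∷ []
  K-isPfS : IsPfS K
  K-isPfS = (λ ()) , (interval-isPf M ≤-refl ∷ []) , ([] ∷ [])
  K∖sK≡[] : ∀ {s} → s ∈ H → K ∖ (s · K) ≡ []
  K∖sK≡[] {s} s∈H =
    trans (cong (λ X → K ∖ (X ∷ [])) (∪-absorbs-segment (All.lookup H-pf s∈H) s≤M))
          (filter-reject (λ Z → ¬? (Z ∈? K)) {xs = []} (λ ∉K → ∉K (here refl)))
    where
    s≤M : All (_≤ suc M) s
    s≤M = All.map ℕP.m≤n⇒m≤1+n (All.lookup (AllP.concat⁻ (xs≤max 0 (concat H))) s∈H)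
  K-invariant : ∀ {s} → s ∈ H → toℚ (length (K ∖ (s · K))) ℚ.< ε ℚ.* toℚ (length K)
  K-invariant s∈H =
    subst₂ ℚ._<_ (cong (toℚ ∘ length) (sym (K∖sK≡[] s∈H))) (sym (ℚP.*-identityʳ ε)) ε>0

𝒜∩K≤K∖1K : ∀ K → length (𝒜? ∩ K) ≤ length (K ∖ ((1 ∷ []) · K))
𝒜∩K≤K∖1K K = length-filter-mono 𝒜? (λ Z → ¬? (Z ∈? ((1 ∷ []) · K))) 1∉⇒∉1K K
  where
  1∉⇒∉1K : ∀ {X} → 𝒜 X → ¬ X ∈ (1 ∷ []) · K
  1∉⇒∉1K 1∉X X∈ with Z , _ , refl ← ∈-map⁻ ((1 ∷ []) ∪_) (∈-deduplicate⁻ (≡-dec _≟_) _ X∈) =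
    1∉X (∈-insert 1 Z)

¬𝒜-dense-and-1-invariant : ∀ {α} → ¬ ∃ λ K →
  IsPfS K × All (λ s → toℚ (length (K ∖ (s · K))) ℚ.< α ℚ.* toℚ (length K)) ((1 ∷ []) ∷ []) ×
  α ℚ.* toℚ (length K) ℚ.≤ toℚ (length (𝒜? ∩ K))
¬𝒜-dense-and-1-invariant {α} (K , _ , K∖1K<αK ∷ [] , αK≤𝒜∩K) = ℚP.<-irrefl refl (begin-strict
  α ℚ.* toℚ (length K)               ≤⟨ αK≤𝒜∩K ⟩
  toℚ (length (𝒜? ∩ K))              ≤⟨ toℚ-mono-≤ (𝒜∩K≤K∖1K K) ⟩
  toℚ (length (K ∖ ((1 ∷ []) · K)))  <⟨ K∖1K<αK ⟩
  α ℚ.* toℚ (length K)               ∎)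
  where open ℚP.≤-Reasoning

¬density-pos : ∀ α → 0ℚ ℚ.< α → ¬ DensityAtLeast 𝒜? α
¬density-pos α α>0 dens =
  ¬𝒜-dense-and-1-invariant {α} (dens ((1 ∷ []) ∷ []) (λ ()) (interval-isPf 0 ≤-refl ∷ []) α α>0)

theorem5p6 : DensityZero 𝒜? ×
    ∃ λ (F : ℕ → List (List ℕ)) → IsFolner F ×
    ∃ λ (Tmax : ℕ → List ℕ) →
    (∀ n → IsPf (Tmax n)) ×
    (∀ n T → IsPf T →
    ratio (length (𝒜? ∩ image (λ Z → Z ∪ T) (F n))) (length (image (λ Z → Z ∪ T) (F n)))
    ℚ.≤ ratio (length (𝒜? ∩ image (λ Z → Z ∪ Tmax n) (F n))) (length (image (λ Z → Z ∪ Tmax n) (F n)))) ×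
    Tendsto (λ n → ratio (length (𝒜? ∩ image (λ Z → Z ∪ Tmax n) (F n))) (length (image (λ Z → Z ∪ Tmax n) (F n)))) ½
theorem5p6 =
  (density-0 , ¬density-pos) ,
  𝓕 , 𝓕-isFolner ,
  T⋆ , (λ n → interval-isPf (n + n) (s≤s z≤n)) ,
  (λ n T _ → subst (ratio (length (𝒜? ∩ translates T n)) (length (translates T n)) ℚ.≤_)
                   (sym (ratio-T⋆ n)) (translates-ratio≤½ T n)) ,
  tendsto-const ratio-T⋆
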